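{- Let $s_1,t_1$ be $\mathcal{L}_{BT}$-terms. There exist $\mathcal{L}_{BT}$-terms $s,t$ and variables $v_1,\ldots,v_k$ such that $\mathfrak{D}\models\neg(s_1\preceq t_1)\leftrightarrow\exists v_1\ldots v_k[s=t]$.
   Context: Bit strings are elements of $\{\mathbf{0},\mathbf{1}\}^*$; $\varepsilon$ is the empty string. The language $\mathcal{L}_{BT}$ has constant symbols $e,0,1$, binary function symbol $\circ$, and binary relation symbol $\preceq$; terms are built from variables and $e,0,1$ with $\circ$. The structure $\mathfrak{D}$ has universe $\{\mathbf{0},\mathbf{1}\}^*$, interprets $e,0,1$ as $\varepsilon,\mathbf{0},\mathbf{1}$, $\circ$ as concatenation, and $\preceq$ as the prefix relation. A formula with free variables holds in $\mathfrak{D}$ if it holds under every assignment. -}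

module Defs where

open import Data.Bool using (Bool; true; false)
open import Data.List using (List; []; _∷_; _++_)
open import Data.Nat using (ℕ; _≟_)
open import Data.Product using (Σ; _×_)
open import Relation.Nullary using (¬_; yes; no)
open import Relation.Binary.PropositionalEquality using (_≡_)

-- Bit strings: false = 𝟎, true = 𝟏
BitString : Set
BitString = List Bool

_⊑_ : BitString → BitString → Set
x ⊑ y = Σ BitString (λ w → x ++ w ≡ y)

Var : Set
Var = ℕ

data Term : Set where
  var  : Var → Term
  e    : Term
  c0   : Term
  c1   : Term
  _∘_  : Term → Term → Term

data Formula : Set where
  _≐_  : Term → Term → Formula
  _≼_  : Term → Term → Formula
  ¬'_  : Formula → Formula
  _⇔'_ : Formula → Formula → Formula
  ∃'   : Var → Formula → Formula

∃* : List Var → Formula → Formula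
∃* []       φ = φ
∃* (v ∷ vs) φ = ∃' v (∃* vs φ)

Assignment : Set
Assignment = Var → BitString

_[_↦_] : Assignment → Var → BitString → Assignment
(ρ [ v ↦ a ]) x with x ≟ v
... | yes _ = a
... | no  _ = ρ x

⟦_⟧ : Term → Assignment → BitString
⟦ var x ⟧ ρ = ρ x
⟦ e ⟧     ρ = []
⟦ c0 ⟧    ρ = false ∷ []
⟦ c1 ⟧    ρ = true ∷ []
⟦ s ∘ t ⟧ ρ = ⟦ s ⟧ ρ ++ ⟦ t ⟧ ρ

_⊨_ : Assignment → Formula → Set
ρ ⊨ (s ≐ t)  = ⟦ s ⟧ ρ ≡ ⟦ t ⟧ ρ
ρ ⊨ (s ≼ t)  = ⟦ s ⟧ ρ ⊑ ⟦ t ⟧ ρ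
ρ ⊨ (¬' φ)   = ¬ (ρ ⊨ φ)
ρ ⊨ (φ ⇔' ψ) = (ρ ⊨ φ → ρ ⊨ ψ) × (ρ ⊨ ψ → ρ ⊨ φ)
ρ ⊨ ∃' v φ   = Σ BitString (λ a → (ρ [ v ↦ a ]) ⊨ φ)

𝔇⊨ : Formula → Set
𝔇⊨ φ = (ρ : Assignment) → ρ ⊨ φ

-- X is not a prefix of Y iff X = U c W and Y c̄ = U c̄ Z for some strings U, W, Z and
-- letter c (padding Y with c̄ covers the case Y = U).  The letters are expressed by
-- string variables A, B with A A B B = R S and S R = 0011: the only conjugates of 0011
-- of the form A A B B are 0011 and 1100, so A, B are complementary letters.  The four
-- equations are merged into one through the injective pairing ⟪P, Q⟫ = P 0 Q P 1 Q, and
-- the witnesses are bound by existential quantifiers over fresh variables.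
module Submission where

open import Defs
open import Data.Bool using (Bool; true; false; not)
open import Data.Bool.Properties using (not-¬; ¬-not) renaming (_≟_ to _≟ᵇ_)
open import Data.Empty using (⊥-elim)
open import Data.List as List using (List; []; _∷_; _++_; length)
open import Data.List.Properties using (++-assoc; ++-cancelˡ; ∷-injective; ∷-injectiveˡ; length-++)
open import Data.Nat using (ℕ; zero; suc; _+_; _<_; _≤_; _⊔_; _≟_)
open import Data.Nat.Properties
  using (+-suc; suc-injective; n<1+n; m<n⇒m<1+n; <⇒≢; m≤m⊔n; m≤n⊔m; m⊔n≤o⇒m≤o; m⊔n≤o⇒n≤o)
open import Data.Product using (Σ; Σ-syntax; _×_; _,_; proj₁; proj₂; map₁)
open import Data.Vec as Vec using (Vec; []; _∷_)
open import Relation.Nullary using (¬_; yes; no)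
open import Relation.Binary.PropositionalEquality
  using (_≡_; _≢_; refl; sym; trans; cong; cong₂; subst; subst₂; module ≡-Reasoning)

++-injective : ∀ {A : Set} (xs ys xs′ ys′ : List A) →
               length xs ≡ length xs′ → xs ++ ys ≡ xs′ ++ ys′ → xs ≡ xs′ × ys ≡ ys′
++-injective []       ys []         ys′ _   eq = refl , eq
++-injective (x ∷ xs) ys (x′ ∷ xs′) ys′ len eq with ∷-injective eq
... | refl , eq′ = map₁ (cong (x ∷_)) (++-injective xs ys xs′ ys′ (suc-injective len) eq′)

m+m≡n+n⇒m≡n : ∀ m n → m + m ≡ n + n → m ≡ n
m+m≡n+n⇒m≡n zero    zero    _  = refl
m+m≡n+n⇒m≡n (suc m) (suc n) eq rewrite +-suc m m | +-suc n n =
  cong suc (m+m≡n+n⇒m≡n m n (suc-injective (suc-injective eq)))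

++-false-true-injective : ∀ (P Q P′ Q′ : BitString) →
  P ++ false ∷ Q ≡ P′ ++ false ∷ Q′ → P ++ true ∷ Q ≡ P′ ++ true ∷ Q′ → P ≡ P′ × Q ≡ Q′
++-false-true-injective []            Q []             Q′ eq₀ _ = refl , proj₂ (∷-injective eq₀)
++-false-true-injective []            Q (false ∷ P′)   Q′ _   ()
++-false-true-injective []            Q (true ∷ P′)    Q′ ()  _
++-false-true-injective (false ∷ P)   Q []             Q′ _   ()
++-false-true-injective (true ∷ P)    Q []             Q′ ()  _
++-false-true-injective (b ∷ P)       Q (b′ ∷ P′)      Q′ eq₀ eq₁
  with ∷-injective eq₀ | ∷-injective eq₁
... | refl , eq₀′ | _ , eq₁′ = map₁ (cong (b ∷_)) (++-false-true-injective P Q P′ Q′ eq₀′ eq₁′)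

⟪_,_⟫ : BitString → BitString → BitString
⟪ P , Q ⟫ = P ++ false ∷ Q ++ P ++ true ∷ Q

⟪,⟫-halves : ∀ P Q → ⟪ P , Q ⟫ ≡ (P ++ false ∷ Q) ++ (P ++ true ∷ Q)
⟪,⟫-halves P Q = sym (++-assoc P (false ∷ Q) (P ++ true ∷ Q))

length-⟪,⟫ : ∀ P Q → let n = length (P ++ false ∷ Q) in length ⟪ P , Q ⟫ ≡ n + n
length-⟪,⟫ P Q = begin
  length ⟪ P , Q ⟫                                          ≡⟨ cong length (⟪,⟫-halves P Q) ⟩
  length ((P ++ false ∷ Q) ++ (P ++ true ∷ Q))             ≡⟨ length-++ (P ++ false ∷ Q) ⟩
  length (P ++ false ∷ Q) + length (P ++ true ∷ Q)         ≡⟨ cong (length (P ++ false ∷ Q) +_) (length-++ P) ⟩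
  length (P ++ false ∷ Q) + (length P + suc (length Q))    ≡⟨ cong (length (P ++ false ∷ Q) +_) (sym (length-++ P)) ⟩
  length (P ++ false ∷ Q) + length (P ++ false ∷ Q)        ∎
  where open ≡-Reasoning

⟪,⟫-injective : ∀ {P Q P′ Q′} → ⟪ P , Q ⟫ ≡ ⟪ P′ , Q′ ⟫ → P ≡ P′ × Q ≡ Q′
⟪,⟫-injective {P} {Q} {P′} {Q′} eq =
  ++-false-true-injective P Q P′ Q′ (proj₁ halves) (proj₂ halves)
  where
  equal-halves : length (P ++ false ∷ Q) ≡ length (P′ ++ false ∷ Q′)
  equal-halves = m+m≡n+n⇒m≡n _ _
    (trans (sym (length-⟪,⟫ P Q)) (trans (cong length eq) (length-⟪,⟫ P′ Q′)))
  halves : P ++ false ∷ Q ≡ P′ ++ false ∷ Q′ × P ++ true ∷ Q ≡ P′ ++ true ∷ Q′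
  halves = ++-injective _ _ _ _ equal-halves
    (trans (sym (⟪,⟫-halves P Q)) (trans eq (⟪,⟫-halves P′ Q′)))

Mismatch : BitString → BitString → Set
Mismatch X Y = Σ[ U ∈ BitString ] Σ[ W ∈ BitString ] Σ[ Z ∈ BitString ] Σ[ c ∈ Bool ]
  X ≡ U ++ c ∷ W × Y ++ not c ∷ [] ≡ U ++ not c ∷ Z

∷-Mismatch : ∀ b {X Y} → Mismatch X Y → Mismatch (b ∷ X) (b ∷ Y)
∷-Mismatch b (U , W , Z , c , eqX , eqY) = b ∷ U , W , Z , c , cong (b ∷_) eqX , cong (b ∷_) eqY

¬⊑⇒Mismatch : ∀ X Y → ¬ X ⊑ Y → Mismatch X Y
¬⊑⇒Mismatch []      Y        X⋢Y = ⊥-elim (X⋢Y (Y , refl))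
¬⊑⇒Mismatch (b ∷ X) []       _   = [] , X , [] , b , refl , refl
¬⊑⇒Mismatch (b ∷ X) (b′ ∷ Y) X⋢Y with b ≟ᵇ b′
... | yes refl = ∷-Mismatch b (¬⊑⇒Mismatch X Y (λ (T , eq) → X⋢Y (T , cong (b ∷_) eq)))
... | no b≢b′ = [] , X , Y ++ not b ∷ [] , b , refl ,
                cong (_∷ Y ++ not b ∷ []) (¬-not (λ b′≡b → b≢b′ (sym b′≡b)))

Mismatch⇒¬⊑ : ∀ {X Y} → Mismatch X Y → ¬ X ⊑ Y
Mismatch⇒¬⊑ (U , W , Z , c , refl , eqY) (T , refl) =
  not-¬ refl (∷-injectiveˡ (++-cancelˡ U _ _ (trans (sym regroup) eqY)))
  where
  regroup : ((U ++ c ∷ W) ++ T) ++ not c ∷ [] ≡ U ++ c ∷ W ++ T ++ not c ∷ []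
  regroup = trans (++-assoc (U ++ c ∷ W) T _) (++-assoc U (c ∷ W) _)

𝟎𝟎𝟏𝟏 : BitString
𝟎𝟎𝟏𝟏 = false ∷ false ∷ true ∷ true ∷ []

squares≡word⇒letters : ∀ {X : Set} (A B : List X) {a b c d : X} →
  A ++ A ++ B ++ B ≡ a ∷ b ∷ c ∷ d ∷ [] → a ≢ c → A ≡ a ∷ [] × a ≡ b × B ≡ c ∷ []
squares≡word⇒letters []            (_ ∷ _ ∷ [])     refl a≢c = ⊥-elim (a≢c refl)
squares≡word⇒letters (_ ∷ [])      (_ ∷ [])         refl _   = refl , refl , refl
squares≡word⇒letters (_ ∷ _ ∷ [])  []               refl a≢c = ⊥-elim (a≢c refl)
squares≡word⇒letters []            []               ()
squares≡word⇒letters []            (_ ∷ [])         ()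
squares≡word⇒letters []            (_ ∷ _ ∷ _ ∷ []) ()
squares≡word⇒letters []            (_ ∷ _ ∷ _ ∷ _ ∷ []) ()
squares≡word⇒letters []            (_ ∷ _ ∷ _ ∷ _ ∷ _ ∷ _) ()
squares≡word⇒letters (_ ∷ [])      []               ()
squares≡word⇒letters (_ ∷ [])      (_ ∷ _ ∷ [])     ()
squares≡word⇒letters (_ ∷ [])      (_ ∷ _ ∷ _ ∷ _)  ()
squares≡word⇒letters (_ ∷ _ ∷ [])  (_ ∷ _)          ()
squares≡word⇒letters (_ ∷ _ ∷ _ ∷ []) _             ()
squares≡word⇒letters (_ ∷ _ ∷ _ ∷ _ ∷ []) _         ()
squares≡word⇒letters (_ ∷ _ ∷ _ ∷ _ ∷ _ ∷ _) _      ()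

ComplementaryLetters : BitString → BitString → Set
ComplementaryLetters A B = Σ[ c ∈ Bool ] A ≡ c ∷ [] × B ≡ not c ∷ []

conjugate-𝟎𝟎𝟏𝟏⇒ComplementaryLetters : ∀ A B R S →
  A ++ A ++ B ++ B ≡ R ++ S → S ++ R ≡ 𝟎𝟎𝟏𝟏 → ComplementaryLetters A B
conjugate-𝟎𝟎𝟏𝟏⇒ComplementaryLetters A B _ [] eq refl
  with squares≡word⇒letters A B eq (λ ())
... | refl , _ , refl = false , refl , refl
conjugate-𝟎𝟎𝟏𝟏⇒ComplementaryLetters A B _ (false ∷ []) eq refl
  with squares≡word⇒letters A B eq (λ ())
... | _ , () , _
conjugate-𝟎𝟎𝟏𝟏⇒ComplementaryLetters A B _ (false ∷ false ∷ []) eq refl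
  with squares≡word⇒letters A B eq (λ ())
... | refl , _ , refl = true , refl , refl
conjugate-𝟎𝟎𝟏𝟏⇒ComplementaryLetters A B _ (false ∷ false ∷ true ∷ []) eq refl
  with squares≡word⇒letters A B eq (λ ())
... | _ , () , _
conjugate-𝟎𝟎𝟏𝟏⇒ComplementaryLetters A B [] (false ∷ false ∷ true ∷ true ∷ []) eq refl
  with squares≡word⇒letters A B eq (λ ())
... | refl , _ , refl = false , refl , refl
conjugate-𝟎𝟎𝟏𝟏⇒ComplementaryLetters _ _ _ (true ∷ _) _ ()
conjugate-𝟎𝟎𝟏𝟏⇒ComplementaryLetters _ _ _ (false ∷ true ∷ _) _ ()
conjugate-𝟎𝟎𝟏𝟏⇒ComplementaryLetters _ _ _ (false ∷ false ∷ false ∷ _) _ ()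
conjugate-𝟎𝟎𝟏𝟏⇒ComplementaryLetters _ _ _ (false ∷ false ∷ true ∷ false ∷ _) _ ()
conjugate-𝟎𝟎𝟏𝟏⇒ComplementaryLetters _ _ _ (false ∷ false ∷ true ∷ true ∷ _ ∷ _) _ ()

letters-conjugate-𝟎𝟎𝟏𝟏 : ∀ c → Σ[ R ∈ BitString ] Σ[ S ∈ BitString ]
  c ∷ c ∷ not c ∷ not c ∷ [] ≡ R ++ S × S ++ R ≡ 𝟎𝟎𝟏𝟏
letters-conjugate-𝟎𝟎𝟏𝟏 false = 𝟎𝟎𝟏𝟏 , [] , refl , refl
letters-conjugate-𝟎𝟎𝟏𝟏 true  = true ∷ true ∷ [] , false ∷ false ∷ [] , refl , refl

NonPrefixSystem : BitString → BitString → Vec BitString 7 → Set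
NonPrefixSystem X Y (U ∷ W ∷ Z ∷ A ∷ B ∷ R ∷ S ∷ []) =
  X ≡ U ++ A ++ W × Y ++ B ≡ U ++ B ++ Z × A ++ A ++ B ++ B ≡ R ++ S × S ++ R ≡ 𝟎𝟎𝟏𝟏

¬⊑⇒NonPrefixSystem : ∀ X Y → ¬ X ⊑ Y → Σ[ ws ∈ Vec BitString 7 ] NonPrefixSystem X Y ws
¬⊑⇒NonPrefixSystem X Y X⋢Y with ¬⊑⇒Mismatch X Y X⋢Y
... | U , W , Z , c , eqX , eqY with letters-conjugate-𝟎𝟎𝟏𝟏 c
...   | R , S , eqRS , eqSR =
  U ∷ W ∷ Z ∷ (c ∷ []) ∷ (not c ∷ []) ∷ R ∷ S ∷ [] , eqX , eqY , eqRS , eqSR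

NonPrefixSystem⇒¬⊑ : ∀ {X Y} ws → NonPrefixSystem X Y ws → ¬ X ⊑ Y
NonPrefixSystem⇒¬⊑ (U ∷ W ∷ Z ∷ A ∷ B ∷ R ∷ S ∷ []) (eqX , eqY , eqRS , eqSR)
  with conjugate-𝟎𝟎𝟏𝟏⇒ComplementaryLetters A B R S eqRS eqSR
... | c , refl , refl = Mismatch⇒¬⊑ (U , W , Z , c , eqX , eqY)

[↦]-hit : ∀ ρ v a → (ρ [ v ↦ a ]) v ≡ a
[↦]-hit ρ v a with v ≟ v
... | yes _  = refl
... | no v≢v = ⊥-elim (v≢v refl)

[↦]-other : ∀ ρ {v x} a → x ≢ v → (ρ [ v ↦ a ]) x ≡ ρ x
[↦]-other ρ {v} {x} a x≢v with x ≟ v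
... | yes x≡v = ⊥-elim (x≢v x≡v)
... | no _    = refl

_[_↦*_] : ∀ {k} → Assignment → Var → Vec BitString k → Assignment
ρ [ N ↦* [] ]     = ρ
ρ [ N ↦* a ∷ as ] = (ρ [ N ↦ a ]) [ suc N ↦* as ]

[↦*]-below : ∀ ρ N {k} (as : Vec BitString k) {x} → x < N → (ρ [ N ↦* as ]) x ≡ ρ x
[↦*]-below ρ N []       _   = refl
[↦*]-below ρ N (a ∷ as) x<N =
  trans ([↦*]-below (ρ [ N ↦ a ]) (suc N) as (m<n⇒m<1+n x<N)) ([↦]-other ρ a (<⇒≢ x<N))

[↦*]-read : ∀ ρ N {k} (as : Vec BitString k) →
            Vec.map (ρ [ N ↦* as ]) (Vec.iterate suc N k) ≡ as
[↦*]-read ρ N []       = refl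
[↦*]-read ρ N (a ∷ as) = cong₂ _∷_
  (trans ([↦*]-below (ρ [ N ↦ a ]) (suc N) as (n<1+n N)) ([↦]-hit ρ N a))
  ([↦*]-read (ρ [ N ↦ a ]) (suc N) as)

∃*-intro : ∀ ρ N {k} (as : Vec BitString k) φ →
           (ρ [ N ↦* as ]) ⊨ φ → ρ ⊨ ∃* (List.iterate suc N k) φ
∃*-intro ρ N []       φ ρ⊨φ = ρ⊨φ
∃*-intro ρ N (a ∷ as) φ ρ⊨φ = a , ∃*-intro (ρ [ N ↦ a ]) (suc N) as φ ρ⊨φ

∃*-elim : ∀ ρ N k φ →
          ρ ⊨ ∃* (List.iterate suc N k) φ → Σ[ as ∈ Vec BitString k ] (ρ [ N ↦* as ]) ⊨ φ
∃*-elim ρ N zero    φ ρ⊨φ       = [] , ρ⊨φ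
∃*-elim ρ N (suc k) φ (a , ρ⊨φ) with ∃*-elim (ρ [ N ↦ a ]) (suc N) k φ ρ⊨φ
... | as , σ⊨φ = a ∷ as , σ⊨φ

fresh : Term → ℕ
fresh (var x) = suc x
fresh e       = 0
fresh c0      = 0
fresh c1      = 0
fresh (s ∘ t) = fresh s ⊔ fresh t

⟦⟧-[↦*]-fresh : ∀ t ρ N {k} (as : Vec BitString k) → fresh t ≤ N → ⟦ t ⟧ (ρ [ N ↦* as ]) ≡ ⟦ t ⟧ ρ
⟦⟧-[↦*]-fresh (var x) ρ N as x<N = [↦*]-below ρ N as x<N
⟦⟧-[↦*]-fresh e       ρ N as _   = refl
⟦⟧-[↦*]-fresh c0      ρ N as _   = refl
⟦⟧-[↦*]-fresh c1      ρ N as _   = refl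
⟦⟧-[↦*]-fresh (s ∘ t) ρ N as s∘t≤N = cong₂ _++_
  (⟦⟧-[↦*]-fresh s ρ N as (m⊔n≤o⇒m≤o (fresh s) (fresh t) s∘t≤N))
  (⟦⟧-[↦*]-fresh t ρ N as (m⊔n≤o⇒n≤o (fresh s) (fresh t) s∘t≤N))

⟪_,_⟫ₜ : Term → Term → Term
⟪ s , t ⟫ₜ = s ∘ (c0 ∘ (t ∘ (s ∘ (c1 ∘ t))))

module NonPrefixEquation (s₁ t₁ : Term) where

  N : Var
  N = fresh (s₁ ∘ t₁)

  -- x 0, …, x 6 stand for the unknowns U, W, Z, A, B, R, S of NonPrefixSystem.
  x : ℕ → Term
  x i = var (i + N)

  variables : List Var
  variables = List.iterate suc N 7

  lhs rhs : Term
  lhs = ⟪ s₁ , ⟪ t₁ ∘ x 4 , ⟪ x 3 ∘ (x 3 ∘ (x 4 ∘ x 4)) , x 6 ∘ x 5 ⟫ₜ ⟫ₜ ⟫ₜ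
  rhs = ⟪ x 0 ∘ (x 3 ∘ x 1) , ⟪ x 0 ∘ (x 4 ∘ x 2) , ⟪ x 5 ∘ x 6 , c0 ∘ (c0 ∘ (c1 ∘ c1)) ⟫ₜ ⟫ₜ ⟫ₜ

  witnesses : Assignment → Vec BitString 7
  witnesses σ = Vec.map σ (Vec.iterate suc N 7)

  ⊨⇒NonPrefixSystem : ∀ σ → σ ⊨ (lhs ≐ rhs) → NonPrefixSystem (⟦ s₁ ⟧ σ) (⟦ t₁ ⟧ σ) (witnesses σ)
  ⊨⇒NonPrefixSystem σ eq =
    let eqX  , eq₂  = ⟪,⟫-injective eq
        eqY  , eq₃  = ⟪,⟫-injective eq₂
        eqRS , eqSR = ⟪,⟫-injective eq₃
    in eqX , eqY , eqRS , eqSR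

  NonPrefixSystem⇒⊨ : ∀ σ → NonPrefixSystem (⟦ s₁ ⟧ σ) (⟦ t₁ ⟧ σ) (witnesses σ) → σ ⊨ (lhs ≐ rhs)
  NonPrefixSystem⇒⊨ σ (eqX , eqY , eqRS , eqSR) =
    cong₂ ⟪_,_⟫ eqX (cong₂ ⟪_,_⟫ eqY (cong₂ ⟪_,_⟫ eqRS eqSR))

  ⟦s₁⟧-fresh : ∀ ρ (ws : Vec BitString 7) → ⟦ s₁ ⟧ (ρ [ N ↦* ws ]) ≡ ⟦ s₁ ⟧ ρ
  ⟦s₁⟧-fresh ρ ws = ⟦⟧-[↦*]-fresh s₁ ρ N ws (m≤m⊔n (fresh s₁) (fresh t₁))

  ⟦t₁⟧-fresh : ∀ ρ (ws : Vec BitString 7) → ⟦ t₁ ⟧ (ρ [ N ↦* ws ]) ≡ ⟦ t₁ ⟧ ρ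
  ⟦t₁⟧-fresh ρ ws = ⟦⟧-[↦*]-fresh t₁ ρ N ws (m≤n⊔m (fresh s₁) (fresh t₁))

  ¬⊑⇒∃*-equation : ∀ ρ → ¬ ⟦ s₁ ⟧ ρ ⊑ ⟦ t₁ ⟧ ρ → ρ ⊨ ∃* variables (lhs ≐ rhs)
  ¬⊑⇒∃*-equation ρ X⋢Y =
    let ws , system = ¬⊑⇒NonPrefixSystem (⟦ s₁ ⟧ ρ) (⟦ t₁ ⟧ ρ) X⋢Y
        σ = ρ [ N ↦* ws ]
    in ∃*-intro ρ N ws (lhs ≐ rhs) (NonPrefixSystem⇒⊨ σ
         (subst₂ (λ X Y → NonPrefixSystem X Y (witnesses σ))
                 (sym (⟦s₁⟧-fresh ρ ws)) (sym (⟦t₁⟧-fresh ρ ws))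
                 (subst (NonPrefixSystem _ _) (sym ([↦*]-read ρ N ws)) system)))

  ∃*-equation⇒¬⊑ : ∀ ρ → ρ ⊨ ∃* variables (lhs ≐ rhs) → ¬ ⟦ s₁ ⟧ ρ ⊑ ⟦ t₁ ⟧ ρ
  ∃*-equation⇒¬⊑ ρ solution =
    let ws , σ⊨equation = ∃*-elim ρ N 7 (lhs ≐ rhs) solution
        σ = ρ [ N ↦* ws ]
    in subst₂ (λ X Y → ¬ X ⊑ Y) (⟦s₁⟧-fresh ρ ws) (⟦t₁⟧-fresh ρ ws)
         (NonPrefixSystem⇒¬⊑ (witnesses σ) (⊨⇒NonPrefixSystem σ σ⊨equation))

lemma19 : (s₁ t₁ : Term) →
    Σ Term (λ s → Σ Term (λ t → Σ (List Var) (λ vs →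
      𝔇⊨ ((¬' (s₁ ≼ t₁)) ⇔' ∃* vs (s ≐ t)))))
lemma19 s₁ t₁ = lhs , rhs , variables , λ ρ → ¬⊑⇒∃*-equation ρ , ∃*-equation⇒¬⊑ ρ
  where open NonPrefixEquation s₁ t₁
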